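{- Let $H$ be a fixed hypergraph on $m$ vertices and let $s_1,\dots,s_m$ be positive integers, with $H(s_1,\dots,s_m)$ the blowup of $H$. Then there is a constant $C$ such that for all sufficiently large $n$, every hypergraph $G$ on $n$ vertices with $R(G)=R(H)$ that contains no subgraph $H(s_1,\dots,s_m)$ satisfies $\mu_H(G)\le C n^{ -\delta}$, where $\delta=\frac{\max\{s_i\colon 1\le i\le m\}}{\prod_{i=1}^m s_i}$; that is, $\mu_H(G)=O(n^{ -\delta})$.
   Context: A hypergraph $G=(V,E)$ has a finite vertex set and edge set $E\subseteq 2^V$ (edges may have different sizes); $R(G)=\{|F|\colon F\in E\}$. $H$ is a subgraph of $G$ if there is an injective $f\colon V(H)\to V(G)$ with $f(F)\in E(G)$ for all $F\in E(H)$. The density $\mu_H(G)$ of $H$ in $G$ is the probability that a uniformly random injective map $f\colon V(H)\to V(G)$ satisfies $f(F)\in E(G)$ for every $F\in E(H)$. For $H$ on vertex set $[m]$, the blowup $H(s_1,\dots,s_m)$ has vertex set $V_1\sqcup\cdots\sqcup V_m$, $|V_i|=s_i$, and edge set $\bigcup_{F\in E(H)}\prod_{i\in F}V_i$. -}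

module Defs where

open import Data.Nat using (ℕ; zero; suc; _+_; _*_; _⊔_; _≡ᵇ_)
open import Data.Bool using (Bool; true; false; _∧_; _∨_; not; if_then_else_)
open import Data.Fin using (Fin; zero; suc; splitAt; _≟_)
open import Data.Fin.Subset using (Subset; ∣_∣)
open import Data.Vec using (Vec; []; _∷_; lookup; tabulate)
import Data.Vec.Functional as VF
open import Data.Sum using (inj₁; inj₂)
open import Data.Product using (Σ; _×_; ∃)
open import Relation.Binary.PropositionalEquality using (_≡_)
open import Relation.Nullary.Decidable using (⌊_⌋)
open import Function.Definitions using (Injective)

record Hypergraph (n : ℕ) : Set where
  field
    isEdge : Subset n → Bool
open Hypergraph public

sumFin : ∀ {m} → (Fin m → ℕ) → ℕ
sumFin {zero}  f = 0
sumFin {suc m} f = f zero + sumFin (λ i → f (suc i))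

prodFin : ∀ {m} → (Fin m → ℕ) → ℕ
prodFin {zero}  f = 1
prodFin {suc m} f = f zero * prodFin (λ i → f (suc i))

maxFin : ∀ {m} → (Fin m → ℕ) → ℕ
maxFin {zero}  f = 0
maxFin {suc m} f = f zero ⊔ maxFin (λ i → f (suc i))

anyFin : ∀ {m} → (Fin m → Bool) → Bool
anyFin {zero}  P = false
anyFin {suc m} P = P zero ∨ anyFin (λ i → P (suc i))

allFin : ∀ {m} → (Fin m → Bool) → Bool
allFin {zero}  P = true
allFin {suc m} P = P zero ∧ allFin (λ i → P (suc i))

countFin : ∀ {m} → (Fin m → Bool) → ℕ
countFin P = sumFin (λ i → if P i then 1 else 0)

anySubset : ∀ {m} → (Subset m → Bool) → Bool
anySubset {zero}  P = P []
anySubset {suc m} P = anySubset (λ F → P (true ∷ F)) ∨ anySubset (λ F → P (false ∷ F))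

allSubset : ∀ {m} → (Subset m → Bool) → Bool
allSubset {zero}  P = P []
allSubset {suc m} P = allSubset (λ F → P (true ∷ F)) ∧ allSubset (λ F → P (false ∷ F))

countMaps : ∀ m n → ((Fin m → Fin n) → Bool) → ℕ
countMaps zero    n P = if P (λ ()) then 1 else 0
countMaps (suc m) n P = sumFin (λ i → countMaps m n (λ g → P (i VF.∷ g)))

image : ∀ {m n} → (Fin m → Fin n) → Subset m → Subset n
image f F = tabulate (λ y → anyFin (λ x → lookup F x ∧ ⌊ f x ≟ y ⌋))

Embeds : ∀ {m n} → Hypergraph m → Hypergraph n → Set
Embeds {m} {n} H G =
  ∃ λ (f : Fin m → Fin n) →
    Injective _≡_ _≡_ f × (∀ F → isEdge H F ≡ true → isEdge G (image f F) ≡ true)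

injectiveB : ∀ {m n} → (Fin m → Fin n) → Bool
injectiveB f = allFin (λ x → allFin (λ y → not ⌊ f x ≟ f y ⌋ ∨ ⌊ x ≟ y ⌋))

copyB : ∀ {m n} → Hypergraph m → Hypergraph n → (Fin m → Fin n) → Bool
copyB H G f = injectiveB f ∧ allSubset (λ F → not (isEdge H F) ∨ isEdge G (image f F))

numInj : ℕ → ℕ → ℕ
numInj m n = countMaps m n injectiveB

numCopies : ∀ {m n} → Hypergraph m → Hypergraph n → ℕ
numCopies {m} {n} H G = countMaps m n (copyB H G)
-- μ_H(G) = numCopies H G / numInj m n

HasEdgeOfSize : ∀ {n} → Hypergraph n → ℕ → Set
HasEdgeOfSize G k = ∃ λ F → isEdge G F ≡ true × ∣ F ∣ ≡ k

SameEdgeSizes : ∀ {n m} → Hypergraph n → Hypergraph m → Set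
SameEdgeSizes G H = ∀ k → (HasEdgeOfSize G k → HasEdgeOfSize H k)
                        × (HasEdgeOfSize H k → HasEdgeOfSize G k)

-- Blowup H(s_1,…,s_m): vertex set Fin (s_1+…+s_m) = V_1 ⊔ … ⊔ V_m,
-- consecutive blocks; part v = the index i with v ∈ V_i.

part : ∀ {m} (s : Fin m → ℕ) → Fin (sumFin s) → Fin m
part {suc m} s v with splitAt (s zero) v
... | inj₁ _ = zero
... | inj₂ w = suc (part (λ i → s (suc i)) w)

-- F is an edge iff F ∈ ∏_{i∈E} V_i for some E ∈ E(H), i.e. F meets V_i
-- in exactly one vertex for i ∈ E and in none for i ∉ E.
blowup : ∀ {m} → Hypergraph m → (s : Fin m → ℕ) → Hypergraph (sumFin s)
isEdge (blowup H s) F =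
  anySubset (λ E → isEdge H E ∧
    allFin (λ i → countFin (λ v → lookup F v ∧ ⌊ part s v ≟ i ⌋)
                    ≡ᵇ (if lookup E i then 1 else 0)))

-- Count homomorphisms rather than copies. Fix i with s i maximal and let t be s with s i
-- replaced by 1. A family of vertex blocks of sizes t all of whose transversals are
-- homomorphisms H → G is a homomorphism H(t) → G; applying the power-mean inequality block by
-- block shows that there are at least hom(H,G)^(∏t) n^(Σt) / n^(m∏t) such families. If G has
-- no copy of H(s), then once all blocks but the i-th are fixed, fewer than s i vertices complete
-- them to an injective family, and at most (Σt)² n^(Σt−1) families are not injective; so there
-- are at most (s i + (Σt)²) n^(Σt−1) families. Comparing the two counts and raising to the
-- power s i gives hom(H,G)^(∏s) n^(s i) = O(n^(m∏s)), and n^m ≤ 2 · numInj m n once n ≥ 2m².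

module Submission where

open import Defs
open import Algebra.Properties.CommutativeMonoid.Sum as ∧Sum using ()
open import Algebra.Properties.Semiring.Sum as Sum using ()
open import Data.Bool using (Bool; true; false; _∧_; _∨_; not; if_then_else_; T)
open import Data.Bool.Properties
  using (∨-zeroʳ; ∧-identityʳ; ∧-conicalˡ; ∧-conicalʳ; ∧-commutativeMonoid)
open import Data.Fin using (Fin; zero; suc; splitAt; fromℕ<; _↑ˡ_; _↑ʳ_) renaming (_≟_ to _≟ᶠ_)
import Data.Fin.Properties as Finₚ
open import Data.Fin.Subset using (Subset)
open import Data.Nat using (ℕ; zero; suc; _+_; _*_; _^_; _≤_; _<_; z≤n; s≤s; NonZero; _≡ᵇ_)
open import Data.Nat.Properties
open import Data.Nat.Tactic.RingSolver using (solve-∀)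
open import Data.Product using (_×_; ∃; _,_; proj₁; proj₂)
open import Data.Sum using (inj₁; inj₂)
open import Data.Unit using (⊤; tt)
open import Data.Vec using ([]; _∷_; lookup)
open import Data.Vec.Properties using (tabulate-cong)
import Data.Vec.Functional as V
open import Data.Vec.Functional.Properties using (∷-cong; ++-cong; lookup-++ˡ; lookup-++ʳ)
open import Function.Definitions using (Injective)
open import Relation.Binary.PropositionalEquality
open import Relation.Nullary using (¬_; yes; no; contradiction)
open import Relation.Nullary.Decidable using (⌊_⌋; ⌊⌋-map′)

open Sum +-*-semiring using (sum; ∑-distrib-+; ∑-comm; *-distribˡ-sum)
open ∧Sum ∧-commutativeMonoid using () renaming (sum to ∧-sum; ∑-comm to ∧-∑-comm)
open import Algebra.Properties.CommutativeSemigroup *-commutativeSemigroup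
  using (x∙yz≈y∙xz; xy∙z≈xz∙y; x∙yz≈yx∙z; [u∙vw]x≈uv∙wx)
open ≤-Reasoning

𝟙 : Bool → ℕ
𝟙 b = if b then 1 else 0

𝟙-+-𝟙-not : ∀ b → 𝟙 b + 𝟙 (not b) ≡ 1
𝟙-+-𝟙-not true  = refl
𝟙-+-𝟙-not false = refl

1≤𝟙⇒true : ∀ {b} → 1 ≤ 𝟙 b → b ≡ true
1≤𝟙⇒true {true} _ = refl

𝟙-split : ∀ a b → 𝟙 a ≤ 𝟙 (a ∧ b) + 𝟙 (not b)
𝟙-split true  true  = s≤s z≤n
𝟙-split true  false = s≤s z≤n
𝟙-split false b     = z≤n

𝟙≤1 : ∀ b → 𝟙 b ≤ 1
𝟙≤1 true  = ≤-refl
𝟙≤1 false = z≤n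

𝟙-∧-≤ʳ : ∀ a b → 𝟙 (a ∧ b) ≤ 𝟙 b
𝟙-∧-≤ʳ true  b = ≤-refl
𝟙-∧-≤ʳ false b = z≤n

𝟙-∧ : ∀ a b → 𝟙 (a ∧ b) ≡ 𝟙 a * 𝟙 b
𝟙-∧ true  b = sym (+-identityʳ (𝟙 b))
𝟙-∧ false b = refl

≟-true⇒≡ : ∀ {k} {a b : Fin k} → ⌊ a ≟ᶠ b ⌋ ≡ true → a ≡ b
≟-true⇒≡ {a = a} {b} eq with a ≟ᶠ b
... | yes a≡b = a≡b

≡⇒≟-true : ∀ {k} {a b : Fin k} → a ≡ b → ⌊ a ≟ᶠ b ⌋ ≡ true
≡⇒≟-true {a = a} {b} a≡b with a ≟ᶠ b
... | yes _  = refl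
... | no a≢b = contradiction a≡b a≢b

≡ᵇ-true⇒≡ : ∀ {a b} → (a ≡ᵇ b) ≡ true → a ≡ b
≡ᵇ-true⇒≡ {a} {b} eq = ≡ᵇ⇒≡ a b (subst T (sym eq) tt)

true-⇔ : ∀ {a b} → (a ≡ true → b ≡ true) → (b ≡ true → a ≡ true) → a ≡ b
true-⇔ {true}  a⇒b b⇒a = sym (a⇒b refl)
true-⇔ {false} {true}  a⇒b b⇒a = b⇒a refl
true-⇔ {false} {false} a⇒b b⇒a = refl

sumFin≡sum : ∀ {k} (f : Fin k → ℕ) → sumFin f ≡ sum f
sumFin≡sum {zero}  f = refl
sumFin≡sum {suc k} f = cong (f zero +_) (sumFin≡sum (λ i → f (suc i)))

sumFin-cong : ∀ {k} {f g : Fin k → ℕ} → (∀ i → f i ≡ g i) → sumFin f ≡ sumFin g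
sumFin-cong {zero}  f≗g = refl
sumFin-cong {suc k} f≗g = cong₂ _+_ (f≗g zero) (sumFin-cong (λ i → f≗g (suc i)))

sumFin-mono-≤ : ∀ {k} {f g : Fin k → ℕ} → (∀ i → f i ≤ g i) → sumFin f ≤ sumFin g
sumFin-mono-≤ {zero}  f≤g = z≤n
sumFin-mono-≤ {suc k} f≤g = +-mono-≤ (f≤g zero) (sumFin-mono-≤ (λ i → f≤g (suc i)))

sumFin-const : ∀ k c → sumFin {k} (λ _ → c) ≡ k * c
sumFin-const zero    c = refl
sumFin-const (suc k) c = cong (c +_) (sumFin-const k c)

sumFin-distrib-+ : ∀ {k} (f g : Fin k → ℕ) → sumFin (λ i → f i + g i) ≡ sumFin f + sumFin g
sumFin-distrib-+ f g = begin-equality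
  sumFin (λ i → f i + g i)  ≡⟨ sumFin≡sum (λ i → f i + g i) ⟩
  sum (λ i → f i + g i)     ≡⟨ ∑-distrib-+ f g ⟩
  sum f + sum g             ≡⟨ cong₂ _+_ (sumFin≡sum f) (sumFin≡sum g) ⟨
  sumFin f + sumFin g       ∎

*-distribˡ-sumFin : ∀ {k} c (f : Fin k → ℕ) → c * sumFin f ≡ sumFin (λ i → c * f i)
*-distribˡ-sumFin c f = begin-equality
  c * sumFin f           ≡⟨ cong (c *_) (sumFin≡sum f) ⟩
  c * sum f              ≡⟨ *-distribˡ-sum c f ⟩
  sum (λ i → c * f i)    ≡⟨ sumFin≡sum (λ i → c * f i) ⟨
  sumFin (λ i → c * f i) ∎

*-distribʳ-sumFin : ∀ {k} c (f : Fin k → ℕ) → sumFin f * c ≡ sumFin (λ i → f i * c)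
*-distribʳ-sumFin c f = begin-equality
  sumFin f * c           ≡⟨ *-comm _ c ⟩
  c * sumFin f           ≡⟨ *-distribˡ-sumFin c f ⟩
  sumFin (λ i → c * f i) ≡⟨ sumFin-cong (λ i → *-comm c (f i)) ⟩
  sumFin (λ i → f i * c) ∎

sumFin²≡sum² : ∀ {k l} (f : Fin k → Fin l → ℕ) →
  sumFin (λ i → sumFin (f i)) ≡ sum (λ i → sum (f i))
sumFin²≡sum² f = trans (sumFin-cong (λ i → sumFin≡sum (f i))) (sumFin≡sum (λ i → sum (f i)))

sumFin-comm : ∀ {k l} (f : Fin k → Fin l → ℕ) →
  sumFin (λ i → sumFin (f i)) ≡ sumFin (λ j → sumFin (λ i → f i j))
sumFin-comm f = trans (sumFin²≡sum² f) (trans (∑-comm f) (sym (sumFin²≡sum² (λ j i → f i j))))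

sumFin-++ : ∀ a b (f : Fin (a + b) → ℕ) →
  sumFin f ≡ sumFin (λ i → f (i ↑ˡ b)) + sumFin (λ j → f (a ↑ʳ j))
sumFin-++ zero    b f = refl
sumFin-++ (suc a) b f = trans (cong (f zero +_) (sumFin-++ a b (λ i → f (suc i))))
  (sym (+-assoc (f zero) _ _))

allFin≡sum : ∀ {k} (P : Fin k → Bool) → allFin P ≡ ∧-sum P
allFin≡sum {zero}  P = refl
allFin≡sum {suc k} P = cong (P zero ∧_) (allFin≡sum (λ i → P (suc i)))

allFin-cong : ∀ {k} {P Q : Fin k → Bool} → (∀ i → P i ≡ Q i) → allFin P ≡ allFin Q
allFin-cong {zero}  P≗Q = refl
allFin-cong {suc k} P≗Q = cong₂ _∧_ (P≗Q zero) (allFin-cong (λ i → P≗Q (suc i)))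

allFin²≡sum² : ∀ {k l} (P : Fin k → Fin l → Bool) →
  allFin (λ i → allFin (P i)) ≡ ∧-sum (λ i → ∧-sum (P i))
allFin²≡sum² P = trans (allFin-cong (λ i → allFin≡sum (P i))) (allFin≡sum (λ i → ∧-sum (P i)))

allFin-comm : ∀ {k l} (P : Fin k → Fin l → Bool) →
  allFin (λ i → allFin (P i)) ≡ allFin (λ j → allFin (λ i → P i j))
allFin-comm P = trans (allFin²≡sum² P) (trans (∧-∑-comm P) (sym (allFin²≡sum² (λ j i → P i j))))

allFin-true : ∀ {k} (P : Fin k → Bool) → allFin P ≡ true → ∀ i → P i ≡ true
allFin-true P all zero    with true ← P zero = refl
allFin-true P all (suc i) with true ← P zero = allFin-true (λ i → P (suc i)) all i

allFin-intro : ∀ {k} (P : Fin k → Bool) → (∀ i → P i ≡ true) → allFin P ≡ true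
allFin-intro {zero}  P P≡true = refl
allFin-intro {suc k} P P≡true rewrite P≡true zero = allFin-intro (λ i → P (suc i)) (λ i → P≡true (suc i))

anyFin-witness : ∀ {k} (P : Fin k → Bool) → anyFin P ≡ true → ∃ λ i → P i ≡ true
anyFin-witness {suc k} P any with P zero in P0
... | true  = zero , P0
... | false = let i , Pi = anyFin-witness (λ i → P (suc i)) any in suc i , Pi

anyFin-intro : ∀ {k} (P : Fin k → Bool) {i} → P i ≡ true → anyFin P ≡ true
anyFin-intro P {zero}  Pi rewrite Pi = refl
anyFin-intro P {suc i} Pi = trans (cong (P zero ∨_) (anyFin-intro (λ i → P (suc i)) Pi)) (∨-zeroʳ _)

anySubset-witness : ∀ {k} (P : Subset k → Bool) → anySubset P ≡ true → ∃ λ F → P F ≡ true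
anySubset-witness {zero}  P any = [] , any
anySubset-witness {suc k} P any with anySubset (λ F → P (true ∷ F)) in P-true
... | true  = let F , PF = anySubset-witness (λ F → P (true ∷ F)) P-true in true ∷ F , PF
... | false = let F , PF = anySubset-witness (λ F → P (false ∷ F)) any in false ∷ F , PF

allSubset-true : ∀ {k} (P : Subset k → Bool) → allSubset P ≡ true → ∀ F → P F ≡ true
allSubset-true {zero}  P all [] = all
allSubset-true {suc k} P all (true ∷ F)  = allSubset-true (λ F → P (true ∷ F)) (∧-conicalˡ _ _ all) F
allSubset-true {suc k} P all (false ∷ F) = allSubset-true (λ F → P (false ∷ F)) (∧-conicalʳ _ _ all) F

allSubset-cong : ∀ {k} {P Q : Subset k → Bool} → (∀ F → P F ≡ Q F) → allSubset P ≡ allSubset Q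
allSubset-cong {zero}  P≗Q = P≗Q []
allSubset-cong {suc k} P≗Q =
  cong₂ _∧_ (allSubset-cong (λ F → P≗Q (true ∷ F))) (allSubset-cong (λ F → P≗Q (false ∷ F)))

countFin-≟ : ∀ {k} (a : Fin k) → countFin (λ i → ⌊ a ≟ᶠ i ⌋) ≡ 1
countFin-≟ {suc k} zero    = cong suc (trans (sumFin-const k 0) (*-zeroʳ k))
countFin-≟ {suc k} (suc a) =
  trans (sumFin-cong (λ i → cong 𝟙 (⌊⌋-map′ _ _ (a ≟ᶠ i)))) (countFin-≟ a)

countFin-≥1 : ∀ {k} (P : Fin k → Bool) {a} → P a ≡ true → 1 ≤ countFin P
countFin-≥1 P {zero}  Pa rewrite Pa = s≤s z≤n
countFin-≥1 P {suc a} Pa = ≤-trans (countFin-≥1 (λ i → P (suc i)) Pa) (m≤n+m _ (𝟙 (P zero)))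

countFin-witness : ∀ {k} (P : Fin k → Bool) → 1 ≤ countFin P → ∃ λ a → P a ≡ true
countFin-witness {suc k} P c≥1 with P zero in P0
... | true  = zero , P0
... | false = let a , Pa = countFin-witness (λ i → P (suc i)) c≥1 in suc a , Pa

countFin≤1⇒unique : ∀ {k} (P : Fin k → Bool) → countFin P ≤ 1 →
  ∀ {a b} → P a ≡ true → P b ≡ true → a ≡ b
countFin≤1⇒unique {suc k} P c≤1 {zero}  {zero}  Pa Pb = refl
countFin≤1⇒unique {suc k} P c≤1 {zero}  {suc b} P0 Pb = contradiction
  (≤-pred (subst (λ x → 𝟙 x + countFin (λ i → P (suc i)) ≤ 1) P0 c≤1))
  (<⇒≱ (countFin-≥1 (λ i → P (suc i)) Pb))
countFin≤1⇒unique {suc k} P c≤1 {suc a} {zero}  Pa Pb =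
  sym (countFin≤1⇒unique P c≤1 Pb Pa)
countFin≤1⇒unique {suc k} P c≤1 {suc a} {suc b} Pa Pb =
  cong suc (countFin≤1⇒unique (λ i → P (suc i)) (≤-trans (m≤n+m _ (𝟙 (P zero))) c≤1) Pa Pb)

unique⇒countFin≤1 : ∀ {k} (P : Fin k → Bool) → (∀ {a b} → P a ≡ true → P b ≡ true → a ≡ b) →
  countFin P ≤ 1
unique⇒countFin≤1 {zero}  P uniq = z≤n
unique⇒countFin≤1 {suc k} P uniq with P zero in P0
... | false = unique⇒countFin≤1 (λ i → P (suc i)) (λ Pa Pb → Finₚ.suc-injective (uniq Pa Pb))
... | true  = ≤-reflexive (cong suc (trans (sumFin-cong none) (trans (sumFin-const k 0) (*-zeroʳ k))))
  where
  none : ∀ i → 𝟙 (P (suc i)) ≡ 0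
  none i with P (suc i) in Pi
  ... | false = refl
  ... | true  with () ← uniq P0 Pi

countFin-injection : ∀ {k} (P : Fin k → Bool) {r} → r ≤ countFin P →
  ∃ λ (g : Fin r → Fin k) → Injective _≡_ _≡_ g × (∀ j → P (g j) ≡ true)
countFin-injection P {zero} _ = (λ ()) , (λ {}) , (λ ())
countFin-injection {suc k} P {suc r} r≤c with P zero in P0
... | false = let g , g-inj , Pg = countFin-injection (λ i → P (suc i)) r≤c in
  (λ j → suc (g j)) , (λ eq → g-inj (Finₚ.suc-injective eq)) , Pg
... | true  = let g , g-inj , Pg = countFin-injection (λ i → P (suc i)) (≤-pred r≤c) in
  (zero V.∷ (λ j → suc (g j))) , cons-injective g g-inj , cons-valid g Pg
  where
  cons-injective : (g : Fin r → Fin k) → Injective _≡_ _≡_ g →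
    Injective _≡_ _≡_ (zero V.∷ (λ j → suc (g j)))
  cons-injective g g-inj {zero}  {zero}  _  = refl
  cons-injective g g-inj {zero}  {suc _} ()
  cons-injective g g-inj {suc _} {zero}  ()
  cons-injective g g-inj {suc a} {suc b} eq = cong suc (g-inj (Finₚ.suc-injective eq))
  cons-valid : (g : Fin r → Fin k) → (∀ j → P (suc (g j)) ≡ true) →
    ∀ j → P ((zero V.∷ (λ j → suc (g j))) j) ≡ true
  cons-valid g Pg zero    = P0
  cons-valid g Pg (suc j) = Pg j

-- The power-mean inequality

^-distribʳ-* : ∀ a b p → (a * b) ^ p ≡ a ^ p * b ^ p
^-distribʳ-* a b zero    = refl
^-distribʳ-* a b (suc p) = begin-equality
  a * b * (a * b) ^ p        ≡⟨ cong (a * b *_) (^-distribʳ-* a b p) ⟩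
  a * b * (a ^ p * b ^ p)    ≡⟨ [m*n]*[o*p]≡[m*o]*[n*p] a b (a ^ p) (b ^ p) ⟩
  a * a ^ p * (b * b ^ p)    ∎

sumFin-*-sumFin : ∀ {k l} (f : Fin k → ℕ) (g : Fin l → ℕ) →
  sumFin f * sumFin g ≡ sumFin (λ i → sumFin (λ j → f i * g j))
sumFin-*-sumFin f g = trans (*-distribʳ-sumFin (sumFin g) f)
  (sumFin-cong (λ i → *-distribˡ-sumFin (f i) g))

sumFin²-symmetrise : ∀ {k} (f : Fin k → Fin k → ℕ) →
  2 * sumFin (λ i → sumFin (f i)) ≡ sumFin (λ i → sumFin (λ j → f i j + f j i))
sumFin²-symmetrise f = begin-equality
  2 * S                                                ≡⟨ cong (S +_) (+-identityʳ S) ⟩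
  S + S                                                ≡⟨ cong (S +_) (sumFin-comm f) ⟩
  S + sumFin (λ i → sumFin (λ j → f j i))
    ≡⟨ sumFin-distrib-+ (λ i → sumFin (f i)) _ ⟨
  sumFin (λ i → sumFin (f i) + sumFin (λ j → f j i))
    ≡⟨ sumFin-cong (λ i → sumFin-distrib-+ (f i) (λ j → f j i)) ⟨
  sumFin (λ i → sumFin (λ j → f i j + f j i))          ∎
  where S = sumFin (λ i → sumFin (f i))

-- (y − x)(v − u) ≥ 0, with both differences written as explicit summands d and e.
rearrangement : ∀ {x y u v} → x ≤ y → u ≤ v → x * v + y * u ≤ x * u + y * v
rearrangement {x} {u = u} x≤y u≤v
  with d , refl ← m≤n⇒∃[o]m+o≡n x≤y | e , refl ← m≤n⇒∃[o]m+o≡n u≤v = begin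
  x * (u + e) + (x + d) * u           ≤⟨ m≤m+n _ (d * e) ⟩
  x * (u + e) + (x + d) * u + d * e   ≡⟨ expand x d u e ⟩
  x * u + (x + d) * (u + e)           ∎
  where
  expand : ∀ x d u e → x * (u + e) + (x + d) * u + d * e ≡ x * u + (x + d) * (u + e)
  expand = solve-∀

^-rearrangement : ∀ x y q → x * y ^ q + y * x ^ q ≤ x * x ^ q + y * y ^ q
^-rearrangement x y q with ≤-total x y
... | inj₁ x≤y = rearrangement x≤y (^-monoˡ-≤ q x≤y)
... | inj₂ y≤x = begin
  x * y ^ q + y * x ^ q  ≡⟨ +-comm (x * y ^ q) _ ⟩
  y * x ^ q + x * y ^ q  ≤⟨ rearrangement y≤x (^-monoˡ-≤ q y≤x) ⟩
  y * y ^ q + x * x ^ q  ≡⟨ +-comm (y * y ^ q) _ ⟩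
  x * x ^ q + y * y ^ q  ∎

chebyshev : ∀ {N} q (a : Fin N → ℕ) →
  sumFin a * sumFin (λ i → a i ^ q) ≤ N * sumFin (λ i → a i ^ suc q)
chebyshev {N} q a = *-cancelˡ-≤ 2 (begin
  2 * (sumFin a * sumFin (λ i → a i ^ q))
    ≡⟨ cong (2 *_) (sumFin-*-sumFin a (λ i → a i ^ q)) ⟩
  2 * sumFin (λ i → sumFin (λ j → a i * a j ^ q))
    ≡⟨ sumFin²-symmetrise (λ i j → a i * a j ^ q) ⟩
  sumFin (λ i → sumFin (λ j → a i * a j ^ q + a j * a i ^ q))
    ≤⟨ sumFin-mono-≤ (λ i → sumFin-mono-≤ (λ j → ^-rearrangement (a i) (a j) q)) ⟩
  sumFin (λ i → sumFin (λ j → a i ^ suc q + a j ^ suc q))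
    ≡⟨ sumFin²-symmetrise (λ i _ → a i ^ suc q) ⟨
  2 * sumFin (λ i → sumFin {N} (λ _ → a i ^ suc q))
    ≡⟨ cong (2 *_) (sumFin-cong (λ i → sumFin-const N (a i ^ suc q))) ⟩
  2 * sumFin (λ i → N * a i ^ suc q)
    ≡⟨ cong (2 *_) (*-distribˡ-sumFin N (λ i → a i ^ suc q)) ⟨
  2 * (N * sumFin (λ i → a i ^ suc q)) ∎)

power-mean : ∀ {N} k (a : Fin N → ℕ) → sumFin a ^ k * N ≤ N ^ k * sumFin (λ i → a i ^ k)
power-mean {N} zero a = ≤-reflexive (cong (_+ 0) (trans (sym (*-identityʳ N)) (sym (sumFin-const N 1))))
power-mean {N} (suc k) a = begin
  Σa * Σa ^ k * N          ≡⟨ *-assoc Σa _ N ⟩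
  Σa * (Σa ^ k * N)        ≤⟨ *-monoʳ-≤ Σa (power-mean k a) ⟩
  Σa * (N ^ k * Σa^k)      ≡⟨ x∙yz≈y∙xz Σa (N ^ k) Σa^k ⟩
  N ^ k * (Σa * Σa^k)      ≤⟨ *-monoʳ-≤ (N ^ k) (chebyshev k a) ⟩
  N ^ k * (N * Σa^[1+k])   ≡⟨ x∙yz≈y∙xz (N ^ k) N Σa^[1+k] ⟩
  N * (N ^ k * Σa^[1+k])   ≡⟨ *-assoc N (N ^ k) Σa^[1+k] ⟨
  N * N ^ k * Σa^[1+k]     ∎
  where
  Σa = sumFin a
  Σa^k = sumFin (λ i → a i ^ k)
  Σa^[1+k] = sumFin (λ i → a i ^ suc k)

_[_]≔_ : ∀ {m} → (Fin m → ℕ) → Fin m → ℕ → Fin m → ℕ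
t [ i ]≔ k = V.updateAt t i (λ _ → k)

prodFin-[]≔1 : ∀ {m} (t : Fin m → ℕ) i → prodFin (t [ i ]≔ 1) * t i ≡ prodFin t
prodFin-[]≔1 {suc m} t zero    =
  trans (cong (_* t zero) (*-identityˡ (prodFin (λ j → t (suc j))))) (*-comm _ (t zero))
prodFin-[]≔1 {suc m} t (suc i) =
  trans (*-assoc (t zero) _ _) (cong (t zero *_) (prodFin-[]≔1 (λ j → t (suc j)) i))

maxFin-attained : ∀ {m} (s : Fin (suc m) → ℕ) → ∃ λ i → maxFin s ≡ s i
maxFin-attained {zero}  s = zero , ⊔-identityʳ (s zero)
maxFin-attained {suc m} s with j , max≡sⱼ ← maxFin-attained (λ i → s (suc i))
                          with ≤-total (s zero) (maxFin (λ i → s (suc i)))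
... | inj₁ s₀≤max = suc j , trans (m≤n⇒m⊔n≡n s₀≤max) max≡sⱼ
... | inj₂ max≤s₀ = zero , m≥n⇒m⊔n≡m max≤s₀

module _ (n : ℕ) where

  sumMaps : ∀ k → ((Fin k → Fin n) → ℕ) → ℕ
  sumMaps zero    w = w V.[]
  sumMaps (suc k) w = sumFin (λ a → sumMaps k (λ f → w (a V.∷ f)))

  PointwiseInvariant : ∀ {k} {A : Set} → ((Fin k → Fin n) → A) → Set
  PointwiseInvariant {k} w = ∀ {f g : Fin k → Fin n} → (∀ i → f i ≡ g i) → w f ≡ w g

  sumMaps-cong : ∀ k {w w′ : (Fin k → Fin n) → ℕ} → (∀ f → w f ≡ w′ f) →
    sumMaps k w ≡ sumMaps k w′
  sumMaps-cong zero    w≗w′ = w≗w′ _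
  sumMaps-cong (suc k) w≗w′ = sumFin-cong (λ a → sumMaps-cong k (λ f → w≗w′ (a V.∷ f)))

  sumMaps-mono-≤ : ∀ k {w w′ : (Fin k → Fin n) → ℕ} → (∀ f → w f ≤ w′ f) →
    sumMaps k w ≤ sumMaps k w′
  sumMaps-mono-≤ zero    w≤w′ = w≤w′ _
  sumMaps-mono-≤ (suc k) w≤w′ = sumFin-mono-≤ (λ a → sumMaps-mono-≤ k (λ f → w≤w′ (a V.∷ f)))

  sumMaps-distrib-+ : ∀ k (w w′ : (Fin k → Fin n) → ℕ) →
    sumMaps k (λ f → w f + w′ f) ≡ sumMaps k w + sumMaps k w′
  sumMaps-distrib-+ zero    w w′ = refl
  sumMaps-distrib-+ (suc k) w w′ = trans
    (sumFin-cong (λ a → sumMaps-distrib-+ k (λ f → w (a V.∷ f)) (λ f → w′ (a V.∷ f))))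
    (sumFin-distrib-+ (λ a → sumMaps k (λ f → w (a V.∷ f))) (λ a → sumMaps k (λ f → w′ (a V.∷ f))))

  *-distribˡ-sumMaps : ∀ k c (w : (Fin k → Fin n) → ℕ) → c * sumMaps k w ≡ sumMaps k (λ f → c * w f)
  *-distribˡ-sumMaps zero    c w = refl
  *-distribˡ-sumMaps (suc k) c w = trans (*-distribˡ-sumFin c (λ a → sumMaps k (λ f → w (a V.∷ f))))
    (sumFin-cong (λ a → *-distribˡ-sumMaps k c (λ f → w (a V.∷ f))))

  *-distribʳ-sumMaps : ∀ k c (w : (Fin k → Fin n) → ℕ) → sumMaps k w * c ≡ sumMaps k (λ f → w f * c)
  *-distribʳ-sumMaps k c w = trans (*-comm (sumMaps k w) c)
    (trans (*-distribˡ-sumMaps k c w) (sumMaps-cong k (λ f → *-comm c (w f))))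

  sumMaps-const : ∀ k c → sumMaps k (λ _ → c) ≡ n ^ k * c
  sumMaps-const zero    c = sym (+-identityʳ c)
  sumMaps-const (suc k) c = begin-equality
    sumFin {n} (λ _ → sumMaps k (λ _ → c))  ≡⟨ sumFin-cong {n} (λ _ → sumMaps-const k c) ⟩
    sumFin {n} (λ _ → n ^ k * c)            ≡⟨ sumFin-const n _ ⟩
    n * (n ^ k * c)                         ≡⟨ *-assoc n (n ^ k) c ⟨
    n * n ^ k * c                           ∎

  sumMaps-sumFin-comm : ∀ k {l} (w : (Fin k → Fin n) → Fin l → ℕ) →
    sumMaps k (λ f → sumFin (w f)) ≡ sumFin (λ j → sumMaps k (λ f → w f j))
  sumMaps-sumFin-comm zero    w = refl
  sumMaps-sumFin-comm (suc k) w = trans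
    (sumFin-cong (λ a → sumMaps-sumFin-comm k (λ f → w (a V.∷ f))))
    (sumFin-comm (λ a j → sumMaps k (λ f → w (a V.∷ f) j)))

  sumMaps-comm : ∀ k l (w : (Fin k → Fin n) → (Fin l → Fin n) → ℕ) →
    sumMaps k (λ f → sumMaps l (w f)) ≡ sumMaps l (λ g → sumMaps k (λ f → w f g))
  sumMaps-comm zero    l w = refl
  sumMaps-comm (suc k) l w = trans
    (sumFin-cong (λ a → sumMaps-comm k l (λ f → w (a V.∷ f))))
    (sym (sumMaps-sumFin-comm l (λ g a → sumMaps k (λ f → w (a V.∷ f) g))))

  power-mean-sumMaps : ∀ k p (w : (Fin k → Fin n) → ℕ) →
    sumMaps k w ^ p * n ^ k ≤ (n ^ k) ^ p * sumMaps k (λ f → w f ^ p)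
  power-mean-sumMaps zero    p w = ≤-reflexive (trans (*-identityʳ _) (trans
    (sym (*-identityˡ _)) (cong (_* w V.[] ^ p) (sym (^-zeroˡ p)))))
  power-mean-sumMaps (suc k) p w = begin
    sumFin S ^ p * (n * n ^ k)                        ≡⟨ *-assoc (sumFin S ^ p) n (n ^ k) ⟨
    sumFin S ^ p * n * n ^ k                          ≤⟨ *-monoˡ-≤ (n ^ k) (power-mean p S) ⟩
    n ^ p * sumFin (λ a → S a ^ p) * n ^ k            ≡⟨ *-assoc (n ^ p) _ (n ^ k) ⟩
    n ^ p * (sumFin (λ a → S a ^ p) * n ^ k)
      ≡⟨ cong (n ^ p *_) (*-distribʳ-sumFin (n ^ k) (λ a → S a ^ p)) ⟩
    n ^ p * sumFin (λ a → S a ^ p * n ^ k)            ≤⟨ *-monoʳ-≤ (n ^ p) (sumFin-mono-≤ (λ a →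
                                                          power-mean-sumMaps k p (λ f → w (a V.∷ f)))) ⟩
    n ^ p * sumFin (λ a → (n ^ k) ^ p * Sᵖ a)
      ≡⟨ cong (n ^ p *_) (*-distribˡ-sumFin ((n ^ k) ^ p) Sᵖ) ⟨
    n ^ p * ((n ^ k) ^ p * sumFin Sᵖ)                  ≡⟨ *-assoc (n ^ p) ((n ^ k) ^ p) (sumFin Sᵖ) ⟨
    n ^ p * (n ^ k) ^ p * sumFin Sᵖ                    ≡⟨ cong (_* sumFin Sᵖ) (^-distribʳ-* n (n ^ k) p) ⟨
    (n * n ^ k) ^ p * sumFin Sᵖ                        ∎
    where
    S Sᵖ : Fin n → ℕ
    S a = sumMaps k (λ f → w (a V.∷ f))
    Sᵖ a = sumMaps k (λ f → w (a V.∷ f) ^ p)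

  sumMaps-allFin : ∀ k (P : Fin n → Bool) →
    sumMaps k (λ f → 𝟙 (allFin (λ j → P (f j)))) ≡ countFin P ^ k
  sumMaps-allFin zero    P = refl
  sumMaps-allFin (suc k) P = begin-equality
    sumFin (λ a → sumMaps k (λ f → 𝟙 (P a ∧ all f)))
      ≡⟨ sumFin-cong (λ a → sumMaps-cong k (λ f → 𝟙-∧ (P a) (all f))) ⟩
    sumFin (λ a → sumMaps k (λ f → 𝟙 (P a) * 𝟙 (all f)))
      ≡⟨ sumFin-cong (λ a → *-distribˡ-sumMaps k (𝟙 (P a)) (λ f → 𝟙 (all f))) ⟨
    sumFin (λ a → 𝟙 (P a) * sumMaps k (λ f → 𝟙 (all f)))
      ≡⟨ *-distribʳ-sumFin (sumMaps k (λ f → 𝟙 (all f))) (λ a → 𝟙 (P a)) ⟨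
    countFin P * sumMaps k (λ f → 𝟙 (all f))
      ≡⟨ cong (countFin P *_) (sumMaps-allFin k P) ⟩
    countFin P * countFin P ^ k ∎
    where
    all : ∀ {k} → (Fin k → Fin n) → Bool
    all f = allFin (λ j → P (f j))

  ∷-invariant : ∀ {k} {A : Set} a {w : (Fin (suc k) → Fin n) → A} → PointwiseInvariant w →
    PointwiseInvariant (λ f → w (a V.∷ f))
  ∷-invariant a w-inv f≗g = w-inv (∷-cong refl f≗g)

  countMaps≡sumMaps : ∀ k (P : (Fin k → Fin n) → Bool) → PointwiseInvariant P →
    countMaps k n P ≡ sumMaps k (λ f → 𝟙 (P f))
  countMaps≡sumMaps zero    P P-inv = cong 𝟙 (P-inv (λ ()))
  countMaps≡sumMaps (suc k) P P-inv =
    sumFin-cong (λ a → countMaps≡sumMaps k (λ f → P (a V.∷ f)) (∷-invariant a P-inv))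

  sumMaps-++ : ∀ a b (w : (Fin (a + b) → Fin n) → ℕ) → PointwiseInvariant w →
    sumMaps (a + b) w ≡ sumMaps a (λ f → sumMaps b (λ g → w (f V.++ g)))
  sumMaps-++ zero    b w w-inv = sumMaps-cong b (λ g → w-inv (λ _ → refl))
  sumMaps-++ (suc a) b w w-inv = sumFin-cong (λ x → trans
    (sumMaps-++ a b (λ f → w (x V.∷ f)) (∷-invariant x w-inv))
    (sumMaps-cong a (λ f → sumMaps-cong b (λ g → w-inv (∷-++ x f g)))))
    where
    ∷-++ : ∀ {a b} x (f : Fin a → Fin n) (g : Fin b → Fin n) i →
      (x V.∷ (f V.++ g)) i ≡ ((x V.∷ f) V.++ g) i
    ∷-++ x f g zero = refl
    ∷-++ {a} x f g (suc i) with splitAt a i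
    ... | inj₁ _ = refl
    ... | inj₂ _ = refl

  Blocks : ∀ {m} → (Fin m → ℕ) → Set
  Blocks {zero}  t = ⊤
  Blocks {suc m} t = (Fin (t zero) → Fin n) × Blocks (λ i → t (suc i))

  sumBlocks : ∀ {m} (t : Fin m → ℕ) → (Blocks t → ℕ) → ℕ
  sumBlocks {zero}  t w = w tt
  sumBlocks {suc m} t w = sumMaps (t zero) (λ x → sumBlocks (λ i → t (suc i)) (λ z → w (x , z)))

  sumBlocks-cong : ∀ {m} (t : Fin m → ℕ) {w w′ : Blocks t → ℕ} → (∀ z → w z ≡ w′ z) →
    sumBlocks t w ≡ sumBlocks t w′
  sumBlocks-cong {zero}  t w≗w′ = w≗w′ tt
  sumBlocks-cong {suc m} t w≗w′ =
    sumMaps-cong (t zero) (λ x → sumBlocks-cong (λ i → t (suc i)) (λ z → w≗w′ (x , z)))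

  sumBlocks-mono-≤ : ∀ {m} (t : Fin m → ℕ) {w w′ : Blocks t → ℕ} → (∀ z → w z ≤ w′ z) →
    sumBlocks t w ≤ sumBlocks t w′
  sumBlocks-mono-≤ {zero}  t w≤w′ = w≤w′ tt
  sumBlocks-mono-≤ {suc m} t w≤w′ =
    sumMaps-mono-≤ (t zero) (λ x → sumBlocks-mono-≤ (λ i → t (suc i)) (λ z → w≤w′ (x , z)))

  sumBlocks-distrib-+ : ∀ {m} (t : Fin m → ℕ) (w w′ : Blocks t → ℕ) →
    sumBlocks t (λ z → w z + w′ z) ≡ sumBlocks t w + sumBlocks t w′
  sumBlocks-distrib-+ {zero}  t w w′ = refl
  sumBlocks-distrib-+ {suc m} t w w′ = trans
    (sumMaps-cong (t zero) (λ x →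
      sumBlocks-distrib-+ (λ i → t (suc i)) (λ z → w (x , z)) (λ z → w′ (x , z))))
    (sumMaps-distrib-+ (t zero) _ _)

  sumBlocks-const : ∀ {m} (t : Fin m → ℕ) c → sumBlocks t (λ _ → c) ≡ n ^ sumFin t * c
  sumBlocks-const {zero}  t c = sym (+-identityʳ c)
  sumBlocks-const {suc m} t c = begin-equality
    sumMaps (t zero) (λ _ → sumBlocks t′ (λ _ → c))
      ≡⟨ sumMaps-cong (t zero) (λ _ → sumBlocks-const t′ c) ⟩
    sumMaps (t zero) (λ _ → n ^ sumFin t′ * c)       ≡⟨ sumMaps-const (t zero) _ ⟩
    n ^ t zero * (n ^ sumFin t′ * c)                 ≡⟨ *-assoc (n ^ t zero) _ c ⟨
    n ^ t zero * n ^ sumFin t′ * c                   ≡⟨ cong (_* c) (^-distribˡ-+-* n (t zero) _) ⟨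
    n ^ (t zero + sumFin t′) * c                     ∎
    where t′ = λ i → t (suc i)

  sumBlocks-sumMaps-comm : ∀ {m} (t : Fin m → ℕ) k (w : Blocks t → (Fin k → Fin n) → ℕ) →
    sumBlocks t (λ z → sumMaps k (w z)) ≡ sumMaps k (λ f → sumBlocks t (λ z → w z f))
  sumBlocks-sumMaps-comm {zero}  t k w = refl
  sumBlocks-sumMaps-comm {suc m} t k w = trans
    (sumMaps-cong (t zero) (λ x → sumBlocks-sumMaps-comm (λ i → t (suc i)) k (λ z → w (x , z))))
    (sumMaps-comm (t zero) k (λ x f → sumBlocks (λ i → t (suc i)) (λ z → w (x , z) f)))

  concat : ∀ {m} (t : Fin m → ℕ) → Blocks t → Fin (sumFin t) → Fin n
  concat {zero}  t _       = V.[]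
  concat {suc m} t (x , z) = x V.++ concat (λ i → t (suc i)) z

  sumBlocks-concat : ∀ {m} (t : Fin m → ℕ) (w : (Fin (sumFin t) → Fin n) → ℕ) → PointwiseInvariant w →
    sumBlocks t (λ z → w (concat t z)) ≡ sumMaps (sumFin t) w
  sumBlocks-concat {zero}  t w w-inv = refl
  sumBlocks-concat {suc m} t w w-inv = trans
    (sumMaps-cong (t zero) (λ x → sumBlocks-concat (λ i → t (suc i)) (λ g → w (x V.++ g))
      (λ f≗g → w-inv (++-cong x x (λ _ → refl) f≗g))))
    (sym (sumMaps-++ (t zero) (sumFin (λ i → t (suc i))) w w-inv))

  allTransversals : ∀ {m} → ((Fin m → Fin n) → Bool) → (t : Fin m → ℕ) → Blocks t → Bool
  allTransversals {zero}  h t _       = h V.[]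
  allTransversals {suc m} h t (x , z) =
    allFin (λ j → allTransversals (λ f → h (x j V.∷ f)) (λ i → t (suc i)) z)

  allTransversals-allFin : ∀ {m k} (h : Fin k → (Fin m → Fin n) → Bool) (t : Fin m → ℕ) (z : Blocks t) →
    allTransversals (λ f → allFin (λ j → h j f)) t z ≡ allFin (λ j → allTransversals (h j) t z)
  allTransversals-allFin {zero}  h t z       = refl
  allTransversals-allFin {suc m} h t (x , z) = trans
    (allFin-cong (λ i → allTransversals-allFin (λ j f → h j (x i V.∷ f)) (λ i → t (suc i)) z))
    (allFin-comm (λ i j → allTransversals (λ f → h j (x i V.∷ f)) (λ i → t (suc i)) z))

  block : ∀ {m} (t : Fin m → ℕ) → Blocks t → (i : Fin m) → Fin (t i) → Fin n
  block {suc m} t (x , z) zero    = x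
  block {suc m} t (x , z) (suc i) = block (λ j → t (suc j)) z i

  concat-in-block : ∀ {m} (t : Fin m → ℕ) (z : Blocks t) v →
    ∃ λ j → concat t z v ≡ block t z (part t v) j
  concat-in-block {suc m} t (x , z) v with splitAt (t zero) v
  ... | inj₁ j = j , refl
  ... | inj₂ w = concat-in-block (λ i → t (suc i)) z w

  -- Lower bound for families of blocks

  blowup-exponent : ∀ m t₀ p → n ^ (suc m * (t₀ * p)) ≡ ((n ^ m) ^ t₀) ^ p * (n ^ t₀) ^ p
  blowup-exponent m t₀ p = begin-equality
    n ^ (t₀ * p + m * (t₀ * p))           ≡⟨ ^-distribˡ-+-* n (t₀ * p) _ ⟩
    n ^ (t₀ * p) * n ^ (m * (t₀ * p))     ≡⟨ *-comm (n ^ (t₀ * p)) _ ⟩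
    n ^ (m * (t₀ * p)) * n ^ (t₀ * p)     ≡⟨ cong (λ e → n ^ e * n ^ (t₀ * p)) (*-assoc m t₀ p) ⟨
    n ^ (m * t₀ * p) * n ^ (t₀ * p)       ≡⟨ cong₂ _*_ (^-*-assoc n (m * t₀) p) (^-*-assoc n t₀ p) ⟨
    (n ^ (m * t₀)) ^ p * (n ^ t₀) ^ p     ≡⟨ cong (λ a → a ^ p * (n ^ t₀) ^ p) (^-*-assoc n m t₀) ⟨
    ((n ^ m) ^ t₀) ^ p * (n ^ t₀) ^ p     ∎

  -- The three hypotheses are the power-mean inequality over the first block, the power-mean
  -- inequality over its fibres, and the induction hypothesis summed over the first block.
  blowup-step : ∀ m t₀ p {cnt S Σc Σt′ Bl} →
    cnt ^ t₀ * n ^ m ≤ (n ^ m) ^ t₀ * S → S ^ p * n ^ t₀ ≤ (n ^ t₀) ^ p * Σc →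
    Σc * n ^ Σt′ ≤ Bl * n ^ (m * p) → .{{_ : NonZero n}} →
    cnt ^ (t₀ * p) * n ^ (t₀ + Σt′) ≤ Bl * n ^ (suc m * (t₀ * p))
  blowup-step m t₀ p {cnt} {S} {Σc} {Σt′} {Bl} first fibres rest =
    *-cancelʳ-≤ _ _ (n ^ (m * p)) {{m^n≢0 n (m * p)}} (begin
    cnt ^ (t₀ * p) * n ^ (t₀ + Σt′) * n ^ (m * p)
      ≡⟨ cong₂ (λ a b → a * n ^ (t₀ + Σt′) * b) (^-*-assoc cnt t₀ p) (^-*-assoc n m p) ⟨
    (cnt ^ t₀) ^ p * n ^ (t₀ + Σt′) * (n ^ m) ^ p
      ≡⟨ xy∙z≈xz∙y ((cnt ^ t₀) ^ p) _ _ ⟩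
    (cnt ^ t₀) ^ p * (n ^ m) ^ p * n ^ (t₀ + Σt′)
      ≡⟨ cong₂ _*_ (^-distribʳ-* (cnt ^ t₀) (n ^ m) p) (sym (^-distribˡ-+-* n t₀ Σt′)) ⟨
    (cnt ^ t₀ * n ^ m) ^ p * (n ^ t₀ * n ^ Σt′)
      ≤⟨ *-monoˡ-≤ (n ^ t₀ * n ^ Σt′) (^-monoˡ-≤ p first) ⟩
    ((n ^ m) ^ t₀ * S) ^ p * (n ^ t₀ * n ^ Σt′)
      ≡⟨ cong (_* (n ^ t₀ * n ^ Σt′)) (^-distribʳ-* ((n ^ m) ^ t₀) S p) ⟩
    A * S ^ p * (n ^ t₀ * n ^ Σt′)
      ≡⟨ *-assoc (A * S ^ p) (n ^ t₀) (n ^ Σt′) ⟨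
    A * S ^ p * n ^ t₀ * n ^ Σt′
      ≡⟨ cong (_* n ^ Σt′) (*-assoc A (S ^ p) (n ^ t₀)) ⟩
    A * (S ^ p * n ^ t₀) * n ^ Σt′
      ≤⟨ *-monoˡ-≤ (n ^ Σt′) (*-monoʳ-≤ A fibres) ⟩
    A * ((n ^ t₀) ^ p * Σc) * n ^ Σt′
      ≡⟨ [u∙vw]x≈uv∙wx A ((n ^ t₀) ^ p) Σc (n ^ Σt′) ⟩
    A * (n ^ t₀) ^ p * (Σc * n ^ Σt′)
      ≤⟨ *-monoʳ-≤ (A * (n ^ t₀) ^ p) rest ⟩
    A * (n ^ t₀) ^ p * (Bl * n ^ (m * p))
      ≡⟨ x∙yz≈yx∙z (A * (n ^ t₀) ^ p) Bl (n ^ (m * p)) ⟩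
    Bl * (A * (n ^ t₀) ^ p) * n ^ (m * p)
      ≡⟨ cong (λ a → Bl * a * n ^ (m * p)) (blowup-exponent m t₀ p) ⟨
    Bl * n ^ (suc m * (t₀ * p)) * n ^ (m * p) ∎)
    where A = ((n ^ m) ^ t₀) ^ p

  -- In densities: dens(all transversals of the t-blowup satisfy h) ≥ dens(h) ^ ∏ t.
  allTransversals-count-≥ : ∀ {m} (t : Fin m → ℕ) (h : (Fin m → Fin n) → Bool) .{{_ : NonZero n}} →
    sumMaps m (λ f → 𝟙 (h f)) ^ prodFin t * n ^ sumFin t
      ≤ sumBlocks t (λ z → 𝟙 (allTransversals h t z)) * n ^ (m * prodFin t)
  allTransversals-count-≥ {zero}  t h = ≤-reflexive (*-identityʳ _)
  allTransversals-count-≥ {suc m} t h = blowup-step m t₀ P′ {Bl = Bl} first-block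
    (power-mean-sumMaps t₀ P′ c) other-blocks
    where
    Bl = sumBlocks t (λ z → 𝟙 (allTransversals h t z))
    t₀ = t zero
    t′ : Fin m → ℕ
    t′ i = t (suc i)
    P′ = prodFin t′
    g : (Fin t₀ → Fin n) → (Fin m → Fin n) → Bool
    g x r = allFin (λ j → h (x j V.∷ r))
    c : (Fin t₀ → Fin n) → ℕ
    c x = sumMaps m (λ r → 𝟙 (g x r))
    d : (Fin m → Fin n) → ℕ
    d r = countFin (λ a → h (a V.∷ r))
    first-block : sumMaps (suc m) (λ f → 𝟙 (h f)) ^ t₀ * n ^ m ≤ (n ^ m) ^ t₀ * sumMaps t₀ c
    first-block = subst₂ (λ a b → a ^ t₀ * n ^ m ≤ (n ^ m) ^ t₀ * b)
      (sumMaps-sumFin-comm m (λ r a → 𝟙 (h (a V.∷ r))))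
      (sym (trans (sumMaps-comm t₀ m (λ x r → 𝟙 (g x r)))
                  (sumMaps-cong m (λ r → sumMaps-allFin t₀ (λ a → h (a V.∷ r))))))
      (power-mean-sumMaps m t₀ d)
    other-blocks : sumMaps t₀ (λ x → c x ^ P′) * n ^ sumFin t′ ≤ Bl * n ^ (m * P′)
    other-blocks = begin
      sumMaps t₀ (λ x → c x ^ P′) * n ^ sumFin t′
        ≡⟨ *-distribʳ-sumMaps t₀ (n ^ sumFin t′) _ ⟩
      sumMaps t₀ (λ x → c x ^ P′ * n ^ sumFin t′)
        ≤⟨ sumMaps-mono-≤ t₀ (λ x → allTransversals-count-≥ t′ (g x)) ⟩
      sumMaps t₀ (λ x → sumBlocks t′ (λ z → 𝟙 (allTransversals (g x) t′ z)) * n ^ (m * P′))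
        ≡⟨ *-distribʳ-sumMaps t₀ (n ^ (m * P′)) _ ⟨
      sumMaps t₀ (λ x → sumBlocks t′ (λ z → 𝟙 (allTransversals (g x) t′ z))) * n ^ (m * P′)
        ≡⟨ cong (_* n ^ (m * P′)) (sumMaps-cong t₀ (λ x → sumBlocks-cong t′ (λ z →
             cong 𝟙 (allTransversals-allFin (λ j r → h (x j V.∷ r)) t′ z)))) ⟩
      Bl * n ^ (m * P′) ∎

  occurrences : ∀ {k} → (Fin k → Fin n) → Fin n → ℕ
  occurrences f x = countFin (λ j → ⌊ f j ≟ᶠ x ⌋)

  injective⇒occurrences≤1 : ∀ {k} (f : Fin k → Fin n) → Injective _≡_ _≡_ f →
    ∀ x → occurrences f x ≤ 1
  injective⇒occurrences≤1 f f-inj x = unique⇒countFin≤1 (λ j → ⌊ f j ≟ᶠ x ⌋)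
    (λ fa≡x fb≡x → f-inj (trans (≟-true⇒≡ fa≡x) (sym (≟-true⇒≡ fb≡x))))

  occurrences≤1⇒injective : ∀ {k} (f : Fin k → Fin n) → (∀ x → occurrences f x ≤ 1) →
    Injective _≡_ _≡_ f
  occurrences≤1⇒injective f occ≤1 {a} fa≡fb =
    countFin≤1⇒unique (λ j → ⌊ f j ≟ᶠ f a ⌋) (occ≤1 (f a)) (≡⇒≟-true refl) (≡⇒≟-true (sym fa≡fb))

  injectiveB⇒injective : ∀ {k} (f : Fin k → Fin n) → injectiveB f ≡ true → Injective _≡_ _≡_ f
  injectiveB⇒injective f inj {a} {b} fa≡fb = ≟-true⇒≡
    (subst (λ e → not e ∨ ⌊ a ≟ᶠ b ⌋ ≡ true) (≡⇒≟-true fa≡fb)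
      (allFin-true _ (allFin-true _ inj a) b))

  injective⇒injectiveB : ∀ {k} (f : Fin k → Fin n) → Injective _≡_ _≡_ f → injectiveB f ≡ true
  injective⇒injectiveB f f-inj = allFin-intro _ λ a → allFin-intro _ λ b → entry a b
    where
    entry : ∀ a b → not ⌊ f a ≟ᶠ f b ⌋ ∨ ⌊ a ≟ᶠ b ⌋ ≡ true
    entry a b with a ≟ᶠ b | f a ≟ᶠ f b
    ... | yes _   | _        = ∨-zeroʳ _
    ... | no _    | no _     = refl
    ... | no a≢b  | yes fa≡fb = contradiction (f-inj fa≡fb) a≢b

  injectiveB-invariant : ∀ {k} → PointwiseInvariant (injectiveB {k} {n})
  injectiveB-invariant f≗g = allFin-cong λ a → allFin-cong λ b →
    cong₂ (λ x y → not ⌊ x ≟ᶠ y ⌋ ∨ ⌊ a ≟ᶠ b ⌋) (f≗g a) (f≗g b)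

  occurrences≡0⇒≢ : ∀ {k} (g : Fin k → Fin n) {a} → occurrences g a ≡ 0 → ∀ j → g j ≢ a
  occurrences≡0⇒≢ g {a} occ≡0 j gj≡a =
    <⇒≱ (countFin-≥1 (λ i → ⌊ g i ≟ᶠ a ⌋) (≡⇒≟-true gj≡a)) (≤-reflexive occ≡0)

  ∷-injective : ∀ {k} a (g : Fin k → Fin n) → Injective _≡_ _≡_ g → occurrences g a ≡ 0 →
    Injective _≡_ _≡_ (a V.∷ g)
  ∷-injective a g g-inj occ≡0 {zero}  {zero}  _  = refl
  ∷-injective a g g-inj occ≡0 {zero}  {suc j} eq = contradiction (sym eq) (occurrences≡0⇒≢ g occ≡0 j)
  ∷-injective a g g-inj occ≡0 {suc i} {zero}  eq = contradiction eq (occurrences≡0⇒≢ g occ≡0 i)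
  ∷-injective a g g-inj occ≡0 {suc i} {suc j} eq = cong suc (g-inj eq)

  nonInjective-∷ : ∀ {k} a (g : Fin k → Fin n) →
    𝟙 (not (injectiveB (a V.∷ g))) ≤ 𝟙 (not (injectiveB g)) + occurrences g a
  nonInjective-∷ a g with injectiveB (a V.∷ g) in ag | injectiveB g in g-inj | occurrences g a in occ
  ... | true  | _     | _     = z≤n
  ... | false | false | _     = s≤s z≤n
  ... | false | true  | suc _ = s≤s z≤n
  ... | false | true  | zero  with () ← trans (sym (injective⇒injectiveB (a V.∷ g)
          (∷-injective a g (injectiveB⇒injective g g-inj) occ))) ag

  occurrences-total : ∀ {k} (g : Fin k → Fin n) → sumFin (occurrences g) ≡ k
  occurrences-total {k} g = begin-equality
    sumFin (λ a → countFin (λ j → ⌊ g j ≟ᶠ a ⌋))  ≡⟨ sumFin-comm (λ a j → 𝟙 ⌊ g j ≟ᶠ a ⌋) ⟩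
    sumFin (λ j → countFin (λ a → ⌊ g j ≟ᶠ a ⌋))  ≡⟨ sumFin-cong (λ j → countFin-≟ (g j)) ⟩
    sumFin {k} (λ _ → 1)                          ≡⟨ trans (sumFin-const k 1) (*-identityʳ k) ⟩
    k                                             ∎

  nonInjective-step : ∀ k → sumMaps (suc k) (λ f → 𝟙 (not (injectiveB f)))
    ≤ n * sumMaps k (λ f → 𝟙 (not (injectiveB f))) + n ^ k * k
  nonInjective-step k = begin
    sumFin (λ a → sumMaps k (λ g → bad (a V.∷ g)))
      ≤⟨ sumFin-mono-≤ (λ a → sumMaps-mono-≤ k (λ g → nonInjective-∷ a g)) ⟩
    sumFin (λ a → sumMaps k (λ g → bad g + occurrences g a))
      ≡⟨ sumFin-cong (λ a → sumMaps-distrib-+ k bad (λ g → occurrences g a)) ⟩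
    sumFin (λ a → Bad + sumMaps k (λ g → occurrences g a))
      ≡⟨ sumFin-distrib-+ (λ _ → Bad) (λ a → sumMaps k (λ g → occurrences g a)) ⟩
    sumFin {n} (λ _ → Bad) + sumFin (λ a → sumMaps k (λ g → occurrences g a))
      ≡⟨ cong₂ _+_ (sumFin-const n Bad) (sym (sumMaps-sumFin-comm k occurrences)) ⟩
    n * Bad + sumMaps k (λ g → sumFin (occurrences g))
      ≡⟨ cong (n * Bad +_) (trans (sumMaps-cong k occurrences-total) (sumMaps-const k k)) ⟩
    n * Bad + n ^ k * k ∎
    where
    bad : ∀ {k} → (Fin k → Fin n) → ℕ
    bad f = 𝟙 (not (injectiveB f))
    Bad = sumMaps k bad

  nonInjective-count : ∀ k → sumMaps k (λ f → 𝟙 (not (injectiveB f))) * n ≤ k * k * n ^ k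
  nonInjective-count zero    = z≤n
  nonInjective-count (suc k) = begin
    sumMaps (suc k) (λ f → 𝟙 (not (injectiveB f))) * n
      ≤⟨ *-monoˡ-≤ n (nonInjective-step k) ⟩
    (n * Bad + n ^ k * k) * n
      ≡⟨ distribute n Bad (n ^ k) k ⟩
    n * (Bad * n) + k * (n * n ^ k)
      ≤⟨ +-monoˡ-≤ (k * (n * n ^ k)) (*-monoʳ-≤ n (nonInjective-count k)) ⟩
    n * (k * k * n ^ k) + k * (n * n ^ k)
      ≡⟨ collect n k (n ^ k) ⟩
    (k * k + k) * (n * n ^ k)
      ≤⟨ *-monoˡ-≤ (n * n ^ k) (≤-trans (m≤m+n (k * k + k) (suc k)) (≤-reflexive (square k))) ⟩
    suc k * suc k * (n * n ^ k) ∎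
    where
    Bad = sumMaps k (λ f → 𝟙 (not (injectiveB f)))
    distribute : ∀ n b x k → (n * b + x * k) * n ≡ n * (b * n) + k * (n * x)
    distribute = solve-∀
    collect : ∀ n k x → n * (k * k * x) + k * (n * x) ≡ (k * k + k) * (n * x)
    collect = solve-∀
    square : ∀ k → k * k + k + suc k ≡ suc k * suc k
    square = solve-∀

  numInj≡sumMaps : ∀ m → numInj m n ≡ sumMaps m (λ f → 𝟙 (injectiveB f))
  numInj≡sumMaps m = countMaps≡sumMaps m injectiveB injectiveB-invariant

  numInj-lower-bound : ∀ m .{{_ : NonZero n}} → 2 * (m * m) ≤ n → n ^ m ≤ 2 * numInj m n
  numInj-lower-bound m 2m²≤n = subst (λ i → n ^ m ≤ 2 * i) (sym (numInj≡sumMaps m))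
    (*-cancelʳ-≤ (n ^ m) (2 * Inj) n (+-cancelˡ-≤ (n ^ m * n) _ _ (begin
      n ^ m * n + n ^ m * n            ≡⟨ cong (λ v → v * n + v * n) all-maps ⟨
      (Inj + Bad) * n + (Inj + Bad) * n ≡⟨ split Inj Bad n ⟩
      2 * Inj * n + 2 * (Bad * n)      ≤⟨ +-monoʳ-≤ (2 * Inj * n) (*-monoʳ-≤ 2 (nonInjective-count m)) ⟩
      2 * Inj * n + 2 * (m * m * n ^ m) ≡⟨ cong (2 * Inj * n +_) (*-assoc 2 (m * m) (n ^ m)) ⟨
      2 * Inj * n + 2 * (m * m) * n ^ m ≤⟨ +-monoʳ-≤ (2 * Inj * n) (*-monoˡ-≤ (n ^ m) 2m²≤n) ⟩
      2 * Inj * n + n * n ^ m          ≡⟨ +-comm (2 * Inj * n) _ ⟩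
      n * n ^ m + 2 * Inj * n          ≡⟨ cong (_+ 2 * Inj * n) (*-comm n (n ^ m)) ⟩
      n ^ m * n + 2 * Inj * n          ∎)))
    where
    Inj = sumMaps m (λ f → 𝟙 (injectiveB f))
    Bad = sumMaps m (λ f → 𝟙 (not (injectiveB f)))
    all-maps : Inj + Bad ≡ n ^ m
    all-maps = begin-equality
      Inj + Bad
        ≡⟨ sumMaps-distrib-+ m _ _ ⟨
      sumMaps m (λ f → 𝟙 (injectiveB f) + 𝟙 (not (injectiveB f)))
        ≡⟨ sumMaps-cong m (λ f → 𝟙-+-𝟙-not (injectiveB f)) ⟩
      sumMaps m (λ _ → 1)
        ≡⟨ trans (sumMaps-const m 1) (*-identityʳ _) ⟩
      n ^ m ∎
    split : ∀ i b n → (i + b) * n + (i + b) * n ≡ 2 * i * n + 2 * (b * n)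
    split = solve-∀

  isHom : ∀ {m} → Hypergraph m → Hypergraph n → (Fin m → Fin n) → Bool
  isHom H G f = allSubset (λ F → not (isEdge H F) ∨ isEdge G (image f F))

  Hits : ∀ {m} → (Fin m → Fin n) → Subset m → Fin n → Set
  Hits f F y = ∃ λ x → lookup F x ≡ true × f x ≡ y

  anyFin⇒Hits : ∀ {k} (f : Fin k → Fin n) F y →
    anyFin (λ x → lookup F x ∧ ⌊ f x ≟ᶠ y ⌋) ≡ true → Hits f F y
  anyFin⇒Hits f F y any with x , Fx∧fx≡y ← anyFin-witness _ any =
    x , ∧-conicalˡ _ _ Fx∧fx≡y , ≟-true⇒≡ (∧-conicalʳ _ _ Fx∧fx≡y)

  Hits⇒anyFin : ∀ {k} (f : Fin k → Fin n) F y →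
    Hits f F y → anyFin (λ x → lookup F x ∧ ⌊ f x ≟ᶠ y ⌋) ≡ true
  Hits⇒anyFin f F y (x , Fx , fx≡y) =
    anyFin-intro (λ x → lookup F x ∧ ⌊ f x ≟ᶠ y ⌋) (cong₂ _∧_ Fx (≡⇒≟-true fx≡y))

  image-≡ : ∀ {k l} (f : Fin k → Fin n) F (g : Fin l → Fin n) E →
    (∀ y → Hits f F y → Hits g E y) → (∀ y → Hits g E y → Hits f F y) → image f F ≡ image g E
  image-≡ f F g E f⇒g g⇒f = tabulate-cong λ y → true-⇔
    (λ any → Hits⇒anyFin g E y (f⇒g y (anyFin⇒Hits f F y any)))
    (λ any → Hits⇒anyFin f F y (g⇒f y (anyFin⇒Hits g E y any)))

  isHom-invariant : ∀ {m} (H : Hypergraph m) (G : Hypergraph n) → PointwiseInvariant (isHom H G)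
  isHom-invariant H G {f} {g} f≗g = allSubset-cong λ F → cong (λ E → not (isEdge H F) ∨ isEdge G E)
    (image-≡ f F g F (λ y (x , Fx , fx≡y) → x , Fx , trans (sym (f≗g x)) fx≡y)
                     (λ y (x , Fx , gx≡y) → x , Fx , trans (f≗g x) gx≡y))

  allTransversals-true : ∀ {m} (h : (Fin m → Fin n) → Bool) → PointwiseInvariant h →
    (t : Fin m → ℕ) (z : Blocks t) → allTransversals h t z ≡ true →
    (τ : Fin m → Fin n) → (∀ i → ∃ λ j → τ i ≡ block t z i j) → h τ ≡ true
  allTransversals-true {zero}  h h-inv t z all τ τ∈z = trans (h-inv (λ ())) all
  allTransversals-true {suc m} h h-inv t (x , z) all τ τ∈z =
    trans (h-inv (∷-cong (proj₂ (τ∈z zero)) (λ _ → refl)))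
      (allTransversals-true (λ f → h (x j V.∷ f)) (∷-invariant (x j) h-inv)
        (λ i → t (suc i)) z (allFin-true _ all j) (λ i → τ (suc i)) (λ i → τ∈z (suc i)))
    where j = proj₁ (τ∈z zero)

  inPart : ∀ {m} (s : Fin m → ℕ) → Subset (sumFin s) → Fin m → Fin (sumFin s) → Bool
  inPart s F i v = lookup F v ∧ ⌊ part s v ≟ᶠ i ⌋

  -- An edge F of H(s) meets part i in one vertex for i ∈ E and in none otherwise; τ picks that
  -- vertex, or an arbitrary vertex of block i when i ∉ E.
  module Representative {m} (s : Fin m → ℕ) (s-pos : ∀ i → 1 ≤ s i) (z : Blocks s) (F : Subset (sumFin s))
                        (E : Subset m) (part-size : ∀ i → countFin (inPart s F i) ≡ 𝟙 (lookup E i)) where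

    pick : ∀ i b → countFin (inPart s F i) ≡ 𝟙 b → Fin n
    pick i true  c≡1 = concat s z (proj₁ (countFin-witness (inPart s F i) (≤-reflexive (sym c≡1))))
    pick i false _   = block s z i (fromℕ< (s-pos i))

    τ : Fin m → Fin n
    τ i = pick i (lookup E i) (part-size i)

    pick-in-block : ∀ i b c≡ → ∃ λ j → pick i b c≡ ≡ block s z i j
    pick-in-block i false c≡0 = fromℕ< (s-pos i) , refl
    pick-in-block i true  c≡1 with v , v∈i ← countFin-witness (inPart s F i) (≤-reflexive (sym c≡1)) =
      subst (λ i → ∃ λ j → concat s z v ≡ block s z i j) (≟-true⇒≡ (∧-conicalʳ _ _ v∈i))
        (concat-in-block s z v)

    pick-unique : ∀ i b c≡ {v} → inPart s F i v ≡ true → pick i b c≡ ≡ concat s z v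
    pick-unique i true  c≡1 v∈i = cong (concat s z)
      (countFin≤1⇒unique (inPart s F i) (≤-reflexive c≡1) (proj₂ (countFin-witness (inPart s F i) _)) v∈i)
    pick-unique i false c≡0 v∈i = contradiction (subst (1 ≤_) c≡0 (countFin-≥1 (inPart s F i) v∈i)) λ ()

    pick-hit : ∀ i {b} c≡ → b ≡ true → ∃ λ v → lookup F v ≡ true × pick i b c≡ ≡ concat s z v
    pick-hit i c≡1 refl with v , v∈i ← countFin-witness (inPart s F i) (≤-reflexive (sym c≡1)) =
      v , ∧-conicalˡ _ _ v∈i , refl

    τ-in-block : ∀ i → ∃ λ j → τ i ≡ block s z i j
    τ-in-block i = pick-in-block i (lookup E i) (part-size i)

    image-concat≡image-τ : image (concat s z) F ≡ image τ E
    image-concat≡image-τ = image-≡ (concat s z) F τ E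
      (λ y (v , Fv , zv≡y) → let v∈part = cong₂ _∧_ Fv (≡⇒≟-true refl) in
        part s v
        , 1≤𝟙⇒true (subst (1 ≤_) (part-size (part s v)) (countFin-≥1 (inPart s F (part s v)) v∈part))
                 , trans (pick-unique (part s v) _ (part-size (part s v)) v∈part) zv≡y)
      (λ y (i , Ei , τi≡y) → let v , Fv , τi≡zv = pick-hit i (part-size i) Ei in
        v , Fv , trans (sym τi≡zv) τi≡y)

  allTransversals⇒embeds : ∀ {m} (H : Hypergraph m) (G : Hypergraph n) (s : Fin m → ℕ) →
    (∀ i → 1 ≤ s i) → (z : Blocks s) → allTransversals (isHom H G) s z ≡ true →
    Injective _≡_ _≡_ (concat s z) → Embeds (blowup H s) G
  allTransversals⇒embeds H G s s-pos z all-hom concat-inj = concat s z , concat-inj , edge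
    where
    edge : ∀ F → isEdge (blowup H s) F ≡ true → isEdge G (image (concat s z) F) ≡ true
    edge F F-edge = trans (cong (isEdge G) image-concat≡image-τ)
      (subst (λ b → not b ∨ isEdge G (image τ E) ≡ true) (∧-conicalˡ _ _ E-blown-up)
        (allSubset-true _
          (allTransversals-true (isHom H G) (isHom-invariant H G) s z all-hom τ τ-in-block) E))
      where
      E-witness = anySubset-witness
        (λ E → isEdge H E ∧ allFin (λ i → countFin (inPart s F i) ≡ᵇ 𝟙 (lookup E i))) F-edge
      E = proj₁ E-witness
      E-blown-up = proj₂ E-witness
      open Representative s s-pos z F E (λ i → ≡ᵇ-true⇒≡ (allFin-true
        (λ i → countFin (inPart s F i) ≡ᵇ 𝟙 (lookup E i)) (∧-conicalʳ (isEdge H E) _ E-blown-up) i))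

  -- Upper bound in the absence of a copy of H(s)

  replaceBlock : ∀ {m} (i : Fin m) (t : Fin m → ℕ) {k k′} →
    Blocks (t [ i ]≔ k) → (Fin k′ → Fin n) → Blocks (t [ i ]≔ k′)
  replaceBlock {suc m} zero    t (x , z) g = g , z
  replaceBlock {suc m} (suc i) t (x , z) g = x , replaceBlock i (λ j → t (suc j)) z g

  restoreBlock : ∀ {m} (i : Fin m) (t : Fin m → ℕ) {k} →
    Blocks (t [ i ]≔ k) → (Fin (t i) → Fin n) → Blocks t
  restoreBlock {suc m} zero    t (x , z) g = g , z
  restoreBlock {suc m} (suc i) t (x , z) g = x , restoreBlock i (λ j → t (suc j)) z g

  -- Re-choosing block i in every possible way counts each family n ^ k times.
  sumBlocks-replaceBlock : ∀ {m} (i : Fin m) (t : Fin m → ℕ) k (w : Blocks (t [ i ]≔ k) → ℕ) →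
    sumBlocks (t [ i ]≔ k) w * n ^ k
      ≡ sumBlocks (t [ i ]≔ k) (λ z → sumMaps k (λ g → w (replaceBlock i t z g)))
  sumBlocks-replaceBlock {suc m} zero t k w = begin-equality
    sumMaps k (λ x → sumBlocks t′ (λ z → w (x , z))) * n ^ k          ≡⟨ *-comm _ (n ^ k) ⟩
    n ^ k * sumMaps k (λ x → sumBlocks t′ (λ z → w (x , z)))          ≡⟨ sumMaps-const k _ ⟨
    sumMaps k (λ _ → sumMaps k (λ g → sumBlocks t′ (λ z → w (g , z))))
      ≡⟨ sumMaps-cong k (λ _ → sumBlocks-sumMaps-comm t′ k (λ z g → w (g , z))) ⟨
    sumMaps k (λ _ → sumBlocks t′ (λ z → sumMaps k (λ g → w (g , z)))) ∎
    where t′ = λ j → t (suc j)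
  sumBlocks-replaceBlock {suc m} (suc i) t k w = trans
    (*-distribʳ-sumMaps (t zero) (n ^ k) _)
    (sumMaps-cong (t zero) (λ x → sumBlocks-replaceBlock i (λ j → t (suc j)) k (λ z → w (x , z))))

  sumBlocks-fiber-≤ : ∀ {m} (i : Fin m) (t : Fin m → ℕ) k (w : Blocks (t [ i ]≔ k) → ℕ) D →
    (∀ z → sumMaps k (λ g → w (replaceBlock i t z g)) ≤ D) →
    sumBlocks (t [ i ]≔ k) w * n ^ k ≤ D * n ^ sumFin (t [ i ]≔ k)
  sumBlocks-fiber-≤ i t k w D fiber≤D = begin
    sumBlocks (t [ i ]≔ k) w * n ^ k
      ≡⟨ sumBlocks-replaceBlock i t k w ⟩
    sumBlocks (t [ i ]≔ k) (λ z → sumMaps k (λ g → w (replaceBlock i t z g)))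
      ≤⟨ sumBlocks-mono-≤ (t [ i ]≔ k) fiber≤D ⟩
    sumBlocks (t [ i ]≔ k) (λ _ → D)
      ≡⟨ sumBlocks-const (t [ i ]≔ k) D ⟩
    n ^ sumFin (t [ i ]≔ k) * D
      ≡⟨ *-comm _ D ⟩
    D * n ^ sumFin (t [ i ]≔ k) ∎

  allTransversals-restoreBlock : ∀ {m} (i : Fin m) (t : Fin m → ℕ) (z : Blocks (t [ i ]≔ 1))
    (g : Fin (t i) → Fin n) h → allTransversals h t (restoreBlock i t z g)
      ≡ allFin (λ j → allTransversals h (t [ i ]≔ 1) (replaceBlock i t z (g j V.∷ V.[])))
  allTransversals-restoreBlock {suc m} zero    t (x , z) g h =
    allFin-cong {t zero} (λ j → sym (∧-identityʳ _))
  allTransversals-restoreBlock {suc m} (suc i) t (x , z) g h = trans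
    (allFin-cong (λ a → allTransversals-restoreBlock i (λ j → t (suc j)) z g (λ f → h (x a V.∷ f))))
    (allFin-comm (λ a j → allTransversals (λ f → h (x a V.∷ f)) ((λ j → t (suc j)) [ i ]≔ 1)
                   (replaceBlock i (λ j → t (suc j)) z (g j V.∷ V.[]))))

  occurrences-++ : ∀ {a b} (f : Fin a → Fin n) (g : Fin b → Fin n) y →
    occurrences (f V.++ g) y ≡ occurrences f y + occurrences g y
  occurrences-++ {a} {b} f g y = trans (sumFin-++ a b (λ v → 𝟙 ⌊ (f V.++ g) v ≟ᶠ y ⌋)) (cong₂ _+_
    (sumFin-cong (λ j → cong (λ x → 𝟙 ⌊ x ≟ᶠ y ⌋) (lookup-++ˡ f g j)))
    (sumFin-cong (λ j → cong (λ x → 𝟙 ⌊ x ≟ᶠ y ⌋) (lookup-++ʳ f g j))))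

  blockOccurrences : ∀ {m} (t : Fin m → ℕ) → Blocks t → Fin n → ℕ
  blockOccurrences {zero}  t _       y = 0
  blockOccurrences {suc m} t (x , z) y = occurrences x y + blockOccurrences (λ i → t (suc i)) z y

  occurrences-concat : ∀ {m} (t : Fin m → ℕ) z y → occurrences (concat t z) y ≡ blockOccurrences t z y
  occurrences-concat {zero}  t z       y = refl
  occurrences-concat {suc m} t (x , z) y = trans (occurrences-++ x (concat (λ i → t (suc i)) z) y)
    (cong (occurrences x y +_) (occurrences-concat (λ i → t (suc i)) z y))

  occurrencesOutside : ∀ {m} (i : Fin m) (t : Fin m → ℕ) {k} → Blocks (t [ i ]≔ k) → Fin n → ℕ
  occurrencesOutside {suc m} zero    t (x , z) y = blockOccurrences (λ j → t (suc j)) z y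
  occurrencesOutside {suc m} (suc i) t (x , z) y = occurrences x y + occurrencesOutside i (λ j → t (suc j)) z y

  blockOccurrences-replaceBlock : ∀ {m} (i : Fin m) (t : Fin m → ℕ) {k k′} (z : Blocks (t [ i ]≔ k))
    (g : Fin k′ → Fin n) y →
    blockOccurrences (t [ i ]≔ k′) (replaceBlock i t z g) y ≡ occurrencesOutside i t z y + occurrences g y
  blockOccurrences-replaceBlock {suc m} zero    t (x , z) g y = +-comm (occurrences g y) _
  blockOccurrences-replaceBlock {suc m} (suc i) t (x , z) g y = trans
    (cong (occurrences x y +_) (blockOccurrences-replaceBlock i (λ j → t (suc j)) z g y))
    (sym (+-assoc (occurrences x y) _ _))

  blockOccurrences-restoreBlock : ∀ {m} (i : Fin m) (t : Fin m → ℕ) {k} (z : Blocks (t [ i ]≔ k))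
    (g : Fin (t i) → Fin n) y →
    blockOccurrences t (restoreBlock i t z g) y ≡ occurrencesOutside i t z y + occurrences g y
  blockOccurrences-restoreBlock {suc m} zero    t (x , z) g y = +-comm (occurrences g y) _
  blockOccurrences-restoreBlock {suc m} (suc i) t (x , z) g y = trans
    (cong (occurrences x y +_) (blockOccurrences-restoreBlock i (λ j → t (suc j)) z g y))
    (sym (+-assoc (occurrences x y) _ _))

  numCopies≤homCount : ∀ {m} (H : Hypergraph m) (G : Hypergraph n) →
    numCopies H G ≤ sumMaps m (λ f → 𝟙 (isHom H G f))
  numCopies≤homCount {m} H G = ≤-trans
    (≤-reflexive (countMaps≡sumMaps m (copyB H G)
      (λ f≗g → cong₂ _∧_ (injectiveB-invariant f≗g) (isHom-invariant H G f≗g))))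
    (sumMaps-mono-≤ m (λ f → 𝟙-∧-≤ʳ (injectiveB f) (isHom H G f)))

  module SingletonBlock {m} (H : Hypergraph m) (G : Hypergraph n) (s : Fin m → ℕ) (s-pos : ∀ i → 1 ≤ s i)
                        (i : Fin m) (no-copy : ¬ Embeds (blowup H s) G) where

    t : Fin m → ℕ
    t = s [ i ]≔ 1

    injectiveCopy : Blocks t → Bool
    injectiveCopy z = allTransversals (isHom H G) t z ∧ injectiveB (concat t z)

    injectiveCopy⇒injective : ∀ z → injectiveCopy z ≡ true → Injective _≡_ _≡_ (concat t z)
    injectiveCopy⇒injective z copy =
      injectiveB⇒injective (concat t z) (∧-conicalʳ (allTransversals (isHom H G) t z) _ copy)

    setVertex : Blocks t → Fin n → Blocks t
    setVertex z a = replaceBlock i s z (a V.∷ V.[])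

    restoreBlock-injective : ∀ z (g : Fin (s i) → Fin n) → Injective _≡_ _≡_ g →
      (∀ j → injectiveCopy (setVertex z (g j)) ≡ true) →
      Injective _≡_ _≡_ (concat s (restoreBlock i s z g))
    restoreBlock-injective z g g-inj copies = occurrences≤1⇒injective _ λ y →
      subst (_≤ 1) (sym (trans (occurrences-concat s _ y) (blockOccurrences-restoreBlock i s z g y)))
        (disjoint y (occurrences g y) refl)
      where
      outside : ∀ y j → occurrencesOutside i s z y + occurrences (g j V.∷ V.[]) y ≤ 1
      outside y j = subst (_≤ 1)
        (trans (occurrences-concat t _ y) (blockOccurrences-replaceBlock i s z (g j V.∷ V.[]) y))
        (injective⇒occurrences≤1 _ (injectiveCopy⇒injective _ (copies j)) y)
      disjoint : ∀ y b → occurrences g y ≡ b → occurrencesOutside i s z y + b ≤ 1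
      disjoint y zero    _ = ≤-trans (≤-reflexive (+-identityʳ _))
                               (≤-trans (m≤m+n _ _) (outside y (fromℕ< (s-pos i))))
      disjoint y (suc b) occ≡
        with j , gj≟y ← countFin-witness (λ j → ⌊ g j ≟ᶠ y ⌋) (subst (1 ≤_) (sym occ≡) (s≤s z≤n))
        = subst (λ a → a + suc b ≤ 1) (sym outside≡0)
            (subst (_≤ 1) occ≡ (injective⇒occurrences≤1 g g-inj y))
        where
        outside≡0 : occurrencesOutside i s z y ≡ 0
        outside≡0 = n≤0⇒n≡0 (+-cancelʳ-≤ 1 _ 0
          (subst (λ b → occurrencesOutside i s z y + (𝟙 b + 0) ≤ 1) gj≟y (outside y j)))

    -- s i vertices completing the same family to injective copies would give a copy of H(s).
    fiber-< : ∀ z → countFin (λ a → injectiveCopy (setVertex z a)) < s i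
    fiber-< z = ≰⇒> λ sᵢ≤count →
      let g , g-inj , copies = countFin-injection (λ a → injectiveCopy (setVertex z a)) sᵢ≤count in
      no-copy (allTransversals⇒embeds H G s s-pos (restoreBlock i s z g)
        (trans (allTransversals-restoreBlock i s z g (isHom H G))
               (allFin-intro _ (λ j → ∧-conicalˡ _ _ (copies j))))
        (restoreBlock-injective z g g-inj copies))

    Σt : ℕ
    Σt = sumFin t

    allTransversals-count-≤ :
      sumBlocks t (λ z → 𝟙 (allTransversals (isHom H G) t z)) * n ≤ (s i + Σt * Σt) * n ^ Σt
    allTransversals-count-≤ = begin
      sumBlocks t (λ z → 𝟙 (hom z)) * n
        ≤⟨ *-monoˡ-≤ n (sumBlocks-mono-≤ t (λ z → 𝟙-split (hom z) (injectiveB (concat t z)))) ⟩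
      sumBlocks t (λ z → 𝟙 (injectiveCopy z) + 𝟙 (not (injectiveB (concat t z)))) * n
        ≡⟨ cong (_* n) (sumBlocks-distrib-+ t _ _) ⟩
      (Copies + NonInjective) * n
        ≡⟨ *-distribʳ-+ n Copies NonInjective ⟩
      Copies * n + NonInjective * n
        ≤⟨ +-mono-≤ copies non-injective ⟩
      s i * n ^ Σt + Σt * Σt * n ^ Σt
        ≡⟨ *-distribʳ-+ (n ^ Σt) (s i) _ ⟨
      (s i + Σt * Σt) * n ^ Σt ∎
      where
      hom = allTransversals (isHom H G) t
      Copies = sumBlocks t (λ z → 𝟙 (injectiveCopy z))
      NonInjective = sumBlocks t (λ z → 𝟙 (not (injectiveB (concat t z))))
      copies : Copies * n ≤ s i * n ^ Σt
      copies = subst (λ x → Copies * x ≤ s i * n ^ Σt) (*-identityʳ n)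
        (sumBlocks-fiber-≤ i s 1 (λ z → 𝟙 (injectiveCopy z)) (s i) (λ z → <⇒≤ (fiber-< z)))
      non-injective : NonInjective * n ≤ Σt * Σt * n ^ Σt
      non-injective = subst (λ x → x * n ≤ Σt * Σt * n ^ Σt)
        (sym (sumBlocks-concat t (λ f → 𝟙 (not (injectiveB f)))
          (λ f≗g → cong (λ b → 𝟙 (not b)) (injectiveB-invariant f≗g))))
        (nonInjective-count Σt)

    homCount-bound : .{{_ : NonZero n}} →
      sumMaps m (λ f → 𝟙 (isHom H G f)) ^ prodFin t * n ≤ (s i + Σt * Σt) * n ^ (m * prodFin t)
    homCount-bound = *-cancelʳ-≤ _ _ (n ^ Σt) {{m^n≢0 n Σt}} (begin
      cnt ^ P′ * n * n ^ Σt       ≡⟨ xy∙z≈xz∙y (cnt ^ P′) n _ ⟩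
      cnt ^ P′ * n ^ Σt * n       ≤⟨ *-monoˡ-≤ n (allTransversals-count-≥ t (isHom H G)) ⟩
      Bl * n ^ (m * P′) * n       ≡⟨ xy∙z≈xz∙y Bl _ n ⟩
      Bl * n * n ^ (m * P′)       ≤⟨ *-monoˡ-≤ (n ^ (m * P′)) allTransversals-count-≤ ⟩
      K * n ^ Σt * n ^ (m * P′)   ≡⟨ xy∙z≈xz∙y K _ _ ⟩
      K * n ^ (m * P′) * n ^ Σt   ∎)
      where
      cnt = sumMaps m (λ f → 𝟙 (isHom H G f))
      Bl = sumBlocks t (λ z → 𝟙 (allTransversals (isHom H G) t z))
      P′ = prodFin t
      K = s i + Σt * Σt

  numCopies-bound : ∀ {m} (H : Hypergraph m) (G : Hypergraph n) (s : Fin m → ℕ) → (∀ i → 1 ≤ s i) →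
    ¬ Embeds (blowup H s) G → .{{_ : NonZero n}} → 2 * (m * m) ≤ n → ∀ i →
    numCopies H G ^ prodFin s * n ^ s i
      ≤ (s i + sumFin (s [ i ]≔ 1) * sumFin (s [ i ]≔ 1)) ^ s i * 2 ^ prodFin s * numInj m n ^ prodFin s
  numCopies-bound {m} H G s s-pos no-copy 2m²≤n i = begin
    numCopies H G ^ P * n ^ M         ≤⟨ *-monoˡ-≤ (n ^ M) (^-monoˡ-≤ P (numCopies≤homCount H G)) ⟩
    cnt ^ P * n ^ M                   ≡⟨ cong (λ e → cnt ^ e * n ^ M) (prodFin-[]≔1 s i) ⟨
    cnt ^ (P′ * M) * n ^ M            ≡⟨ cong (_* n ^ M) (^-*-assoc cnt P′ M) ⟨
    (cnt ^ P′) ^ M * n ^ M            ≡⟨ ^-distribʳ-* (cnt ^ P′) n M ⟨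
    (cnt ^ P′ * n) ^ M                ≤⟨ ^-monoˡ-≤ M homCount-bound ⟩
    (K * n ^ (m * P′)) ^ M            ≡⟨ ^-distribʳ-* K (n ^ (m * P′)) M ⟩
    K ^ M * (n ^ (m * P′)) ^ M        ≡⟨ cong (K ^ M *_) exponent ⟩
    K ^ M * (n ^ m) ^ P               ≤⟨ *-monoʳ-≤ (K ^ M) (^-monoˡ-≤ P (numInj-lower-bound m 2m²≤n)) ⟩
    K ^ M * (2 * numInj m n) ^ P      ≡⟨ cong (K ^ M *_) (^-distribʳ-* 2 (numInj m n) P) ⟩
    K ^ M * (2 ^ P * numInj m n ^ P)  ≡⟨ *-assoc (K ^ M) (2 ^ P) _ ⟨
    K ^ M * 2 ^ P * numInj m n ^ P    ∎
    where
    open SingletonBlock H G s s-pos i no-copy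
    M = s i
    P = prodFin s
    P′ = prodFin t
    K = s i + Σt * Σt
    cnt = sumMaps m (λ f → 𝟙 (isHom H G f))
    exponent : (n ^ (m * P′)) ^ M ≡ (n ^ m) ^ P
    exponent = begin-equality
      (n ^ (m * P′)) ^ M  ≡⟨ ^-*-assoc n (m * P′) M ⟩
      n ^ (m * P′ * M)    ≡⟨ cong (n ^_) (trans (*-assoc m P′ M) (cong (m *_) (prodFin-[]≔1 s i))) ⟩
      n ^ (m * P)         ≡⟨ ^-*-assoc n m P ⟨
      (n ^ m) ^ P         ∎

mainTheorem16 : ∀ {m} (H : Hypergraph m) (s : Fin m → ℕ) → (∀ i → 1 ≤ s i) →
    ∃ λ (C : ℕ) → ∃ λ (N : ℕ) → ∀ (n : ℕ) → N ≤ n → (G : Hypergraph n) →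
      SameEdgeSizes G H → ¬ Embeds (blowup H s) G →
      numCopies H G ^ prodFin s * n ^ maxFin s ≤ C * numInj m n ^ prodFin s
mainTheorem16 {zero} H s s-pos = 1 , 0 , λ n _ G _ _ → begin
  numCopies H G * 1 * 1            ≡⟨ trans (*-identityʳ _) (*-identityʳ _) ⟩
  numCopies H G                    ≤⟨ numCopies≤homCount n H G ⟩
  𝟙 (isHom n H G V.[])             ≤⟨ 𝟙≤1 _ ⟩
  1                                ∎
mainTheorem16 {suc m} H s s-pos with i , max≡sᵢ ← maxFin-attained s = C , N , bound
  where
  Σt = sumFin (s [ i ]≔ 1)
  C = (s i + Σt * Σt) ^ s i * 2 ^ prodFin s
  N = suc (2 * (suc m * suc m))
  bound : ∀ n → N ≤ n → (G : Hypergraph n) → SameEdgeSizes G H → ¬ Embeds (blowup H s) G →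
    numCopies H G ^ prodFin s * n ^ maxFin s ≤ C * numInj (suc m) n ^ prodFin s
  bound (suc n) (s≤s 2m²≤n) G _ no-copy rewrite max≡sᵢ =
    numCopies-bound (suc n) H G s s-pos no-copy (≤-trans 2m²≤n (n≤1+n n)) i
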